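{- Let $f:\mathbb{Z}^n_2\rightarrow \mathbb{Z}_q$ with $2^{h-1}<q\leq 2^h$, written as $f(x)=a_0(x)+2a_1(x)+\cdots+2^{h-1}a_{h-1}(x)=\sum_{i=0}^{h-1}c_ia_i(x)$ with $c_i=2^i$ and Boolean component functions $a_i:\mathbb{Z}_2^n\to\mathbb{Z}_2$. For $i=0,\ldots,2^h-1$ let $z_i=(z_{i,0},\ldots,z_{i,h-1})\in\mathbb{Z}_2^h$ be the binary vector with integer representation $i$, let $\Theta_i(x)=(-1)^{z_{i,0}a_0(x)\oplus\cdots\oplus z_{i,h-1}a_{h-1}(x)}$, and let $W_i(u)$ denote the Walsh–Hadamard transform at $u\in\mathbb{Z}_2^n$ of the Boolean function $z_{i,0}a_0(x)\oplus\cdots\oplus z_{i,h-1}a_{h-1}(x)$ (normalized in the same way as $\mathcal{H}_f$). Then: 1. $\zeta^{f(x)}=\zeta^{\sum_{i=0}^{h-1}c_ia_i(x)}=\sum_{i=0}^{2^h-1}\alpha_i\Theta_i(x)$ for all $x\in\mathbb{Z}_2^n$, where $\alpha_i=2^{ -h}H^{(i)}_{2^h}B$ and $B$ is the column vector $B=[\zeta^{z_k\odot(c_0,\ldots,c_{h-1})}]_{k=0}^{2^h-1}$. 2. Consequently, $\mathcal{H}_f(u)=\sum_{i=0}^{2^h-1}\alpha_iW_i(u)$ for all $u\in\mathbb{Z}_2^n$.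
   Context: $\zeta=e^{2\pi i/q}$ is a primitive complex $q$-th root of unity. The generalized Walsh–Hadamard transform of $f:\mathbb{Z}_2^n\to\mathbb{Z}_q$ is $\mathcal{H}_f(u)=2^{ -n/2}\sum_{x\in\mathbb{Z}_2^n}\zeta^{f(x)}(-1)^{u\cdot x}$, and the Walsh–Hadamard transform of a Boolean function $g$ is $W_g(u)=2^{ -n/2}\sum_{x}(-1)^{g(x)\oplus u\cdot x}$. $H_{2^h}$ is the $2^h\times 2^h$ Sylvester–Hadamard matrix ($H_1=(1)$, $H_{2^k}=\begin{pmatrix}H_{2^{k-1}}&H_{2^{k-1}}\\H_{2^{k-1}}&-H_{2^{k-1}}\end{pmatrix}$), whose $k$-th row is $H^{(k)}_{2^h}=((-1)^{z_k\cdot z_0},\ldots,(-1)^{z_k\cdot z_{2^h-1}})$. For $x,y$, $x\odot y=x_1y_1+\cdots+x_ny_n \pmod q$ (inner product modulo $q$), while $x\cdot y$ denotes the inner product over $\mathbb{Z}_2$. -}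

module Defs where

open import Level using (Level)
open import Data.Bool using (Bool; true; false; not; _∧_; _xor_; if_then_else_)
open import Data.Nat using (ℕ; zero; suc; _^_) renaming (_+_ to _+ℕ_; _*_ to _*ℕ_)
open import Data.Nat using ( _%_; ⌊_/2⌋; NonZero)
open import Data.Fin using (Fin; toℕ)
open import Data.Vec.Functional using (_∷_)
open import Algebra.Bundles using (CommutativeRing)

isOdd : ℕ → Bool
isOdd zero    = false
isOdd (suc m) = not (isOdd m)

bit : ℕ → ℕ → Bool
bit m zero    = isOdd m
bit m (suc j) = bit ⌊ m /2⌋ j

zvec : (h : ℕ) → Fin (2 ^ h) → (Fin h → Bool)
zvec h i j = bit (toℕ i) (toℕ j)

dot2 : (m : ℕ) → (Fin m → Bool) → (Fin m → Bool) → Bool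
dot2 zero    x y = false
dot2 (suc m) x y = (x Data.Fin.zero ∧ y Data.Fin.zero)
                   xor dot2 m (λ j → x (Data.Fin.suc j)) (λ j → y (Data.Fin.suc j))

b2n : Bool → ℕ
b2n false = 0
b2n true  = 1

sumℕ : (m : ℕ) → (Fin m → ℕ) → ℕ
sumℕ zero    g = 0
sumℕ (suc m) g = g Data.Fin.zero +ℕ sumℕ m (λ j → g (Data.Fin.suc j))

cvec : (h : ℕ) → Fin h → ℕ
cvec h i = 2 ^ toℕ i

odot : (q : ℕ) .{{_ : NonZero q}} (h : ℕ) → (Fin h → Bool) → (Fin h → ℕ) → ℕ
odot q h x y = sumℕ h (λ j → b2n (x j) *ℕ y j) % q

comboFun : (n h : ℕ) → (Fin h → (Fin n → Bool) → Bool) → Fin (2 ^ h) → (Fin n → Bool) → Bool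
comboFun n h a i x = dot2 h (zvec h i) (λ j → a j x)

module RingDefs {c ℓ : Level} (R : CommutativeRing c ℓ) where
  open CommutativeRing R

  pow : Carrier → ℕ → Carrier
  pow x zero    = 1#
  pow x (suc m) = x * pow x m

  sgn : Bool → Carrier
  sgn false = 1#
  sgn true  = - 1#

  sumFin : (m : ℕ) → (Fin m → Carrier) → Carrier
  sumFin zero    g = 0#
  sumFin (suc m) g = g Data.Fin.zero + sumFin m (λ j → g (Data.Fin.suc j))

  sumCube : (m : ℕ) → ((Fin m → Bool) → Carrier) → Carrier
  sumCube zero    g = g (λ ())
  sumCube (suc m) g = sumCube m (λ x → g (false ∷ x)) + sumCube m (λ x → g (true ∷ x))

  hadamard : (h : ℕ) → Fin (2 ^ h) → Fin (2 ^ h) → Carrier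
  hadamard h k l = sgn (dot2 h (zvec h k) (zvec h l))

  -- Walsh–Hadamard transform of a Boolean function g, with normalization
  -- factor s^n (s plays the role of 1/√2, so s^n = 2^{-n/2}).
  walsh : (s : Carrier) (n : ℕ) → ((Fin n → Bool) → Bool) → (Fin n → Bool) → Carrier
  walsh s n g u = pow s n * sumCube n (λ x → sgn (g x xor dot2 n u x))

  genWalsh : (s ζ : Carrier) (q n : ℕ) → ((Fin n → Bool) → Fin q) → (Fin n → Bool) → Carrier
  genWalsh s ζ q n f u = pow s n * sumCube n (λ x → pow ζ (toℕ (f x)) * sgn (dot2 n u x))

  Bvec : (ζ : Carrier) (q : ℕ) .{{_ : NonZero q}} (h : ℕ) → Fin (2 ^ h) → Carrier
  Bvec ζ q h k = pow ζ (odot q h (zvec h k) (cvec h))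

  -- α_i = 2^{-h} H^{(i)}_{2^h} B, with 2^{-h} = (s·s)^h
  alpha : (s ζ : Carrier) (q : ℕ) .{{_ : NonZero q}} (h : ℕ) → Fin (2 ^ h) → Carrier
  alpha s ζ q h i = pow (s * s) h * sumFin (2 ^ h) (λ k → hadamard h i k * Bvec ζ q h k)

  Theta : (n h : ℕ) → (Fin h → (Fin n → Bool) → Bool) → Fin (2 ^ h) → (Fin n → Bool) → Carrier
  Theta n h a i x = sgn (comboFun n h a i x)

module Submission where

-- Identify Z_2^h with the index set {0,…,2^h − 1} through binary digits. The
-- rows of H_{2^h} are then the characters y ↦ (−1)^{z_i·y}, and the
-- coefficients α_i = 2^{-h} H^{(i)} B are the normalised Fourier coefficients
-- of Φ(y) = ζ^{y ⊙ c}. Part 1 is Fourier inversion on Z_2^h, which follows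
-- coordinate by coordinate from the one-bit case (X + Y) ± (X − Y) ∈ {2X, 2Y},
-- evaluated at the digit vector of f(x), where Φ takes the value ζ^{f(x)}.
-- Part 2 is the linearity of the Walsh transform applied to part 1, since
-- Θ_i(x)·(−1)^{u·x} = (−1)^{(z_i·a(x)) ⊕ u·x}.

open import Defs
open import Level using (Level)
open import Data.Bool using (Bool; true; false; not; _∧_; _xor_)
open import Data.Bool.Properties using (∧-comm)
import Data.Nat as ℕ
open import Data.Nat using (ℕ; zero; suc; _^_; _<_; _≤_; NonZero; ⌊_/2⌋; _%_)
import Data.Nat.Properties as ℕ
open import Data.Nat.DivMod using (m<n⇒m%n≡m)
open import Data.Fin using (Fin; toℕ)
import Data.Fin as Fin
open import Data.Fin.Properties using (toℕ<n)
open import Data.Vec.Functional using (_∷_; tail)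
open import Data.Vec.Functional.Properties using (∷-cong)
open import Data.Product using (_×_; _,_)
open import Function using (_∘_)
open import Relation.Binary.Core using (_Preserves_⟶_)
open import Relation.Binary.PropositionalEquality using (_≡_; _≗_)
import Relation.Binary.PropositionalEquality as ≡
open import Algebra.Bundles using (CommutativeRing)

double : ℕ → ℕ
double zero    = zero
double (suc m) = suc (suc (double m))

2*m≡double : ∀ m → 2 ℕ.* m ≡ double m
2*m≡double zero    = ≡.refl
2*m≡double (suc m) = ≡.cong suc (≡.trans (ℕ.+-suc m (m ℕ.+ 0)) (≡.cong suc (2*m≡double m)))

⌊double/2⌋≡id : ∀ m → ⌊ double m /2⌋ ≡ m
⌊double/2⌋≡id zero    = ≡.refl
⌊double/2⌋≡id (suc m) = ≡.cong suc (⌊double/2⌋≡id m)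

⌊1+double/2⌋≡id : ∀ m → ⌊ suc (double m) /2⌋ ≡ m
⌊1+double/2⌋≡id zero    = ≡.refl
⌊1+double/2⌋≡id (suc m) = ≡.cong suc (⌊1+double/2⌋≡id m)

isOdd-double : ∀ m → isOdd (double m) ≡ false
isOdd-double zero    = ≡.refl
isOdd-double (suc m) = ≡.cong (not ∘ not) (isOdd-double m)

bits : (h : ℕ) → ℕ → Fin h → Bool
bits h m j = bit m (toℕ j)

bits-double : ∀ h m → bits (suc h) (double m) ≗ false ∷ bits h m
bits-double h m = ∷-cong (isOdd-double m) (λ j → ≡.cong (λ k → bit k (toℕ j)) (⌊double/2⌋≡id m))

bits-1+double : ∀ h m → bits (suc h) (suc (double m)) ≗ true ∷ bits h m
bits-1+double h m = ∷-cong (≡.cong not (isOdd-double m)) (λ j → ≡.cong (λ k → bit k (toℕ j)) (⌊1+double/2⌋≡id m))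

dot2-comm : ∀ m x y → dot2 m x y ≡ dot2 m y x
dot2-comm zero    x y = ≡.refl
dot2-comm (suc m) x y = ≡.cong₂ _xor_ (∧-comm (x Fin.zero) (y Fin.zero)) (dot2-comm m (tail x) (tail y))

dot2-cong : ∀ m {x x′ y y′} → x ≗ x′ → y ≗ y′ → dot2 m x y ≡ dot2 m x′ y′
dot2-cong zero    x≗x′ y≗y′ = ≡.refl
dot2-cong (suc m) x≗x′ y≗y′ =
  ≡.cong₂ _xor_ (≡.cong₂ _∧_ (x≗x′ Fin.zero) (y≗y′ Fin.zero)) (dot2-cong m (x≗x′ ∘ Fin.suc) (y≗y′ ∘ Fin.suc))

sumℕ-cong : ∀ m {g g′ : Fin m → ℕ} → g ≗ g′ → sumℕ m g ≡ sumℕ m g′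
sumℕ-cong zero    g≗g′ = ≡.refl
sumℕ-cong (suc m) g≗g′ = ≡.cong₂ ℕ._+_ (g≗g′ Fin.zero) (sumℕ-cong m (g≗g′ ∘ Fin.suc))

odot-congˡ : ∀ q .{{_ : NonZero q}} h {x x′} (y : Fin h → ℕ) → x ≗ x′ → odot q h x y ≡ odot q h x′ y
odot-congˡ q h y x≗x′ = ≡.cong (_% q) (sumℕ-cong h (λ j → ≡.cong (λ b → b2n b ℕ.* y j) (x≗x′ j)))

odot-cvec-binary : ∀ q .{{_ : NonZero q}} h (w : Fin h → Bool) (v : Fin q) →
                   toℕ v ≡ sumℕ h (λ j → cvec h j ℕ.* b2n (w j)) → odot q h w (cvec h) ≡ toℕ v
odot-cvec-binary q h w v v≡ =
  ≡.trans (≡.cong (_% q) (≡.trans (sumℕ-cong h (λ j → ℕ.*-comm (b2n (w j)) (cvec h j))) (≡.sym v≡)))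
          (m<n⇒m%n≡m (toℕ<n v))

module _ {c ℓ : Level} (R : CommutativeRing c ℓ) where
  open CommutativeRing R
  open RingDefs R
  open import Algebra.Properties.Ring ring using (-1*x≈-x; -‿involutive; -‿+-comm)
  open import Algebra.Properties.CommutativeSemigroup +-commutativeSemigroup
    using () renaming (interchange to +-interchange)
  open import Algebra.Properties.CommutativeSemigroup *-commutativeSemigroup
    using (x∙yz≈y∙xz) renaming (interchange to *-interchange)
  open import Algebra.Properties.Semiring.Sum semiring
    using (sum; sum-cong-≋; ∑-distrib-+; *-distribˡ-sum; *-distribʳ-sum)
  open import Relation.Binary.Reasoning.Setoid setoid

  sumFin≡sum : ∀ m (g : Fin m → Carrier) → sumFin m g ≡ sum g
  sumFin≡sum zero    g = ≡.refl
  sumFin≡sum (suc m) g = ≡.cong (g Fin.zero +_) (sumFin≡sum m (tail g))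

  sumFin-cong : ∀ m {f g : Fin m → Carrier} → (∀ j → f j ≈ g j) → sumFin m f ≈ sumFin m g
  sumFin-cong m {f} {g} f≈g rewrite sumFin≡sum m f | sumFin≡sum m g = sum-cong-≋ f≈g

  sumFin-+ : ∀ m (f g : Fin m → Carrier) → sumFin m (λ j → f j + g j) ≈ sumFin m f + sumFin m g
  sumFin-+ m f g rewrite sumFin≡sum m (λ j → f j + g j) | sumFin≡sum m f | sumFin≡sum m g = ∑-distrib-+ f g

  sumFin-distribˡ : ∀ m a (f : Fin m → Carrier) → a * sumFin m f ≈ sumFin m (λ j → a * f j)
  sumFin-distribˡ m a f rewrite sumFin≡sum m f | sumFin≡sum m (λ j → a * f j) = *-distribˡ-sum a f

  sumFin-distribʳ : ∀ m a (f : Fin m → Carrier) → sumFin m f * a ≈ sumFin m (λ j → f j * a)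
  sumFin-distribʳ m a f rewrite sumFin≡sum m f | sumFin≡sum m (λ j → f j * a) = *-distribʳ-sum a f

  sumCube-cong : ∀ n {f g : (Fin n → Bool) → Carrier} → (∀ x → f x ≈ g x) → sumCube n f ≈ sumCube n g
  sumCube-cong zero    f≈g = f≈g _
  sumCube-cong (suc n) f≈g = +-cong (sumCube-cong n (f≈g ∘ (false ∷_))) (sumCube-cong n (f≈g ∘ (true ∷_)))

  sumCube-+ : ∀ n (f g : (Fin n → Bool) → Carrier) → sumCube n (λ x → f x + g x) ≈ sumCube n f + sumCube n g
  sumCube-+ zero    f g = refl
  sumCube-+ (suc n) f g = trans (+-cong (sumCube-+ n _ _) (sumCube-+ n _ _)) (+-interchange _ _ _ _)

  sumCube-distribˡ : ∀ n a (f : (Fin n → Bool) → Carrier) → a * sumCube n f ≈ sumCube n (λ x → a * f x)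
  sumCube-distribˡ zero    a f = refl
  sumCube-distribˡ (suc n) a f = trans (distribˡ a _ _) (+-cong (sumCube-distribˡ n a _) (sumCube-distribˡ n a _))

  sumCube-sumFin-comm : ∀ n m (G : (Fin n → Bool) → Fin m → Carrier) →
                        sumCube n (λ x → sumFin m (G x)) ≈ sumFin m (λ i → sumCube n (λ x → G x i))
  sumCube-sumFin-comm zero    m G = refl
  sumCube-sumFin-comm (suc n) m G =
    trans (+-cong (sumCube-sumFin-comm n m _) (sumCube-sumFin-comm n m _)) (sym (sumFin-+ m _ _))

  sumFin-double : ∀ m (g : ℕ → Carrier) →
                  sumFin (double m) (g ∘ toℕ) ≈ sumFin m (g ∘ double ∘ toℕ) + sumFin m (g ∘ suc ∘ double ∘ toℕ)
  sumFin-double zero    g = sym (+-identityʳ 0#)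
  sumFin-double (suc m) g = begin
    g 0 + (g 1 + sumFin (double m) (g ∘ suc ∘ suc ∘ toℕ))  ≈⟨ sym (+-assoc _ _ _) ⟩
    (g 0 + g 1) + sumFin (double m) (g ∘ suc ∘ suc ∘ toℕ)  ≈⟨ +-congˡ (sumFin-double m (g ∘ suc ∘ suc)) ⟩
    (g 0 + g 1) + (evens + odds)                           ≈⟨ +-interchange _ _ _ _ ⟩
    (g 0 + evens) + (g 1 + odds)                           ∎
    where
    evens = sumFin m (g ∘ suc ∘ suc ∘ double ∘ toℕ)
    odds  = sumFin m (g ∘ suc ∘ suc ∘ suc ∘ double ∘ toℕ)

  sumFin-zvec : ∀ h (G : (Fin h → Bool) → Carrier) → G Preserves _≗_ ⟶ _≈_ →
                sumFin (2 ^ h) (λ i → G (zvec h i)) ≈ sumCube h G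
  sumFin-zvec zero    G G-resp = trans (+-identityʳ _) (G-resp (λ ()))
  sumFin-zvec (suc h) G G-resp = begin
    sumFin (2 ^ suc h) (λ i → G (bits (suc h) (toℕ i)))
      ≡⟨ ≡.cong (λ N → sumFin N (λ i → G (bits (suc h) (toℕ i)))) (2*m≡double (2 ^ h)) ⟩
    sumFin (double (2 ^ h)) (λ i → G (bits (suc h) (toℕ i)))
      ≈⟨ sumFin-double (2 ^ h) (G ∘ bits (suc h)) ⟩
    sumFin (2 ^ h) (λ i → G (bits (suc h) (double (toℕ i))))
      + sumFin (2 ^ h) (λ i → G (bits (suc h) (suc (double (toℕ i)))))
      ≈⟨ +-cong (sumFin-cong (2 ^ h) (λ i → G-resp (bits-double h (toℕ i))))
                (sumFin-cong (2 ^ h) (λ i → G-resp (bits-1+double h (toℕ i)))) ⟩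
    sumFin (2 ^ h) (λ i → G (false ∷ zvec h i)) + sumFin (2 ^ h) (λ i → G (true ∷ zvec h i))
      ≈⟨ +-cong (sumFin-zvec h (G ∘ (false ∷_)) (λ e → G-resp (∷-cong ≡.refl e)))
                (sumFin-zvec h (G ∘ (true ∷_)) (λ e → G-resp (∷-cong ≡.refl e))) ⟩
    sumCube (suc h) G ∎

  sgn-xor : ∀ a b → sgn (a xor b) ≈ sgn a * sgn b
  sgn-xor false b     = sym (*-identityˡ _)
  sgn-xor true  false = sym (*-identityʳ _)
  sgn-xor true  true  = sym (trans (-1*x≈-x (- 1#)) (-‿involutive 1#))

  pow-inverse : ∀ {x y} n → x * y ≈ 1# → pow x n * pow y n ≈ 1#
  pow-inverse zero    xy≈1 = *-identityʳ 1#
  pow-inverse (suc n) xy≈1 =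
    trans (*-interchange _ _ _ _) (trans (*-cong xy≈1 (pow-inverse n xy≈1)) (*-identityʳ 1#))

  -- The summation variable comes first in dot2, so that splitting the sum
  -- over its first coordinate makes dot2 compute.
  fourier : (h : ℕ) → ((Fin h → Bool) → Carrier) → (Fin h → Bool) → Carrier
  fourier h G v = sumCube h (λ y → sgn (dot2 h y v) * G y)

  signed-respects-≗ : ∀ h v (G : (Fin h → Bool) → Carrier) → G Preserves _≗_ ⟶ _≈_ →
                      (λ y → sgn (dot2 h y v) * G y) Preserves _≗_ ⟶ _≈_
  signed-respects-≗ h v G G-resp e = *-cong (reflexive (≡.cong sgn (dot2-cong h e (λ _ → ≡.refl)))) (G-resp e)

  fourier-respects-≗ : ∀ h G → fourier h G Preserves _≗_ ⟶ _≈_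
  fourier-respects-≗ h G e = sumCube-cong h (λ y → *-congʳ (reflexive (≡.cong sgn (dot2-cong h (λ _ → ≡.refl) e))))

  fourier-cong : ∀ h {F G : (Fin h → Bool) → Carrier} → (∀ y → F y ≈ G y) → ∀ v → fourier h F v ≈ fourier h G v
  fourier-cong h F≈G v = sumCube-cong h (λ y → *-congˡ (F≈G y))

  fourier-linear : ∀ h F G a v → fourier h (λ y → F y + a * G y) v ≈ fourier h F v + a * fourier h G v
  fourier-linear h F G a v = begin
    sumCube h (λ y → σ y * (F y + a * G y))
      ≈⟨ sumCube-cong h (λ y → trans (distribˡ _ _ _) (+-congˡ (x∙yz≈y∙xz _ _ _))) ⟩
    sumCube h (λ y → σ y * F y + a * (σ y * G y))
      ≈⟨ sumCube-+ h _ _ ⟩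
    fourier h F v + sumCube h (λ y → a * (σ y * G y))
      ≈⟨ +-congˡ (sym (sumCube-distribˡ h a _)) ⟩
    fourier h F v + a * fourier h G v ∎
    where
    σ : (Fin h → Bool) → Carrier
    σ y = sgn (dot2 h y v)

  fourier-suc : ∀ h G v → fourier (suc h) G v ≈
                fourier h (G ∘ (false ∷_)) (tail v) + sgn (v Fin.zero) * fourier h (G ∘ (true ∷_)) (tail v)
  fourier-suc h G v = +-congˡ (begin
    sumCube h (λ y → sgn (v Fin.zero xor dot2 h y (tail v)) * G (true ∷ y))
      ≈⟨ sumCube-cong h (λ y → trans (*-congʳ (sgn-xor (v Fin.zero) (dot2 h y (tail v)))) (*-assoc _ _ _)) ⟩
    sumCube h (λ y → sgn (v Fin.zero) * (sgn (dot2 h y (tail v)) * G (true ∷ y)))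
      ≈⟨ sym (sumCube-distribˡ h _ _) ⟩
    sgn (v Fin.zero) * fourier h (G ∘ (true ∷_)) (tail v) ∎)

  x+x≈2*x : ∀ x → x + x ≈ (1# + 1#) * x
  x+x≈2*x x = sym (trans (distribʳ x 1# 1#) (+-cong (*-identityˡ x) (*-identityˡ x)))

  two-point-inversion : ∀ (Z : Bool → Carrier) b →
                        (Z false + sgn false * Z true) + sgn b * (Z false + sgn true * Z true) ≈ (1# + 1#) * Z b
  two-point-inversion Z false = begin
    (X + 1# * Y) + 1# * (X + - 1# * Y)  ≈⟨ +-cong (+-congˡ (*-identityˡ Y)) (trans (*-identityˡ _) (+-congˡ (-1*x≈-x Y))) ⟩
    (X + Y) + (X + - Y)                 ≈⟨ +-interchange X Y X (- Y) ⟩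
    (X + X) + (Y + - Y)                 ≈⟨ trans (+-congˡ (-‿inverseʳ Y)) (+-identityʳ _) ⟩
    X + X                               ≈⟨ x+x≈2*x X ⟩
    (1# + 1#) * X                       ∎
    where X = Z false; Y = Z true
  two-point-inversion Z true = begin
    (X + 1# * Y) + - 1# * (X + - 1# * Y)  ≈⟨ +-cong (+-congˡ (*-identityˡ Y)) (trans (-1*x≈-x _) (-‿cong (+-congˡ (-1*x≈-x Y)))) ⟩
    (X + Y) + - (X + - Y)                 ≈⟨ +-congˡ (trans (sym (-‿+-comm X (- Y))) (+-congˡ (-‿involutive Y))) ⟩
    (X + Y) + (- X + Y)                   ≈⟨ +-interchange X Y (- X) Y ⟩
    (X + - X) + (Y + Y)                   ≈⟨ trans (+-congʳ (-‿inverseʳ X)) (+-identityˡ _) ⟩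
    Y + Y                                 ≈⟨ x+x≈2*x Y ⟩
    (1# + 1#) * Y                         ∎
    where X = Z false; Y = Z true

  fourier-involutive : ∀ h G → G Preserves _≗_ ⟶ _≈_ → ∀ w → fourier h (fourier h G) w ≈ pow (1# + 1#) h * G w
  fourier-involutive zero    G G-resp w = *-congˡ (trans (*-identityˡ _) (G-resp (λ ())))
  fourier-involutive (suc h) G G-resp w = begin
    fourier (suc h) F w
      ≈⟨ fourier-suc h F w ⟩
    fourier h (F ∘ (false ∷_)) (tail w) + sgn (w Fin.zero) * fourier h (F ∘ (true ∷_)) (tail w)
      ≈⟨ +-cong (half false) (*-congˡ (half true)) ⟩
    (Z false + sgn false * Z true) + sgn (w Fin.zero) * (Z false + sgn true * Z true)
      ≈⟨ two-point-inversion Z (w Fin.zero) ⟩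
    (1# + 1#) * (P * G (w Fin.zero ∷ tail w))
      ≈⟨ *-congˡ (*-congˡ (G-resp (∷-cong ≡.refl (λ _ → ≡.refl)))) ⟩
    (1# + 1#) * (P * G w)
      ≈⟨ sym (*-assoc _ _ _) ⟩
    pow (1# + 1#) (suc h) * G w ∎
    where
    F = fourier (suc h) G
    P = pow (1# + 1#) h
    G[_∷] : Bool → (Fin h → Bool) → Carrier
    G[ b ∷] = G ∘ (b ∷_)
    Z : Bool → Carrier
    Z b = P * G (b ∷ tail w)
    half : ∀ b → fourier h (F ∘ (b ∷_)) (tail w) ≈ Z false + sgn b * Z true
    half b = begin
      fourier h (F ∘ (b ∷_)) (tail w)
        ≈⟨ fourier-cong h (λ y → fourier-suc h G (b ∷ y)) (tail w) ⟩
      fourier h (λ y → fourier h G[ false ∷] y + sgn b * fourier h G[ true ∷] y) (tail w)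
        ≈⟨ fourier-linear h _ _ (sgn b) (tail w) ⟩
      fourier h (fourier h G[ false ∷]) (tail w) + sgn b * fourier h (fourier h G[ true ∷]) (tail w)
        ≈⟨ +-cong (fourier-involutive h G[ false ∷] (λ e → G-resp (∷-cong ≡.refl e)) (tail w))
                  (*-congˡ (fourier-involutive h G[ true ∷] (λ e → G-resp (∷-cong ≡.refl e)) (tail w))) ⟩
      Z false + sgn b * Z true ∎

  hadamard-expansion : ∀ s → (s * s) * (1# + 1#) ≈ 1# →
                       ∀ h (Φ : (Fin h → Bool) → Carrier) → Φ Preserves _≗_ ⟶ _≈_ → ∀ w →
                       Φ w ≈ sumFin (2 ^ h) (λ i → (pow (s * s) h * sumFin (2 ^ h) (λ k → hadamard h i k * Φ (zvec h k)))
                                                   * sgn (dot2 h (zvec h i) w))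
  hadamard-expansion s s²2≈1 h Φ Φ-resp w = sym (begin
    sumFin N (λ i → (K * row i) * sgn (dot2 h (zvec h i) w))
      ≈⟨ sumFin-cong N (λ i → trans (*-assoc _ _ _) (*-congˡ (trans (*-comm _ _) (*-congˡ (row≈fourier i))))) ⟩
    sumFin N (λ i → K * (sgn (dot2 h (zvec h i) w) * fourier h Φ (zvec h i)))
      ≈⟨ sym (sumFin-distribˡ N K _) ⟩
    K * sumFin N (λ i → sgn (dot2 h (zvec h i) w) * fourier h Φ (zvec h i))
      ≈⟨ *-congˡ (sumFin-zvec h _ (signed-respects-≗ h w _ (fourier-respects-≗ h Φ))) ⟩
    K * fourier h (fourier h Φ) w
      ≈⟨ *-congˡ (fourier-involutive h Φ Φ-resp w) ⟩
    K * (pow (1# + 1#) h * Φ w)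
      ≈⟨ sym (*-assoc _ _ _) ⟩
    (K * pow (1# + 1#) h) * Φ w
      ≈⟨ trans (*-congʳ (pow-inverse h s²2≈1)) (*-identityˡ _) ⟩
    Φ w ∎)
    where
    N = 2 ^ h
    K = pow (s * s) h
    row : Fin N → Carrier
    row i = sumFin N (λ k → hadamard h i k * Φ (zvec h k))
    row≈fourier : ∀ i → row i ≈ fourier h Φ (zvec h i)
    row≈fourier i = trans
      (sumFin-cong N (λ k → *-congʳ (reflexive (≡.cong sgn (dot2-comm h (zvec h i) (zvec h k))))))
      (sumFin-zvec h _ (signed-respects-≗ h (zvec h i) Φ Φ-resp))

  walsh-of-expansion : ∀ s n (φ : (Fin n → Bool) → Carrier) m (α : Fin m → Carrier) (g : Fin m → (Fin n → Bool) → Bool) →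
                       (∀ x → φ x ≈ sumFin m (λ i → α i * sgn (g i x))) →
                       ∀ u → pow s n * sumCube n (λ x → φ x * sgn (dot2 n u x)) ≈ sumFin m (λ i → α i * walsh s n (g i) u)
  walsh-of-expansion s n φ m α g φ≈ u = begin
    pow s n * sumCube n (λ x → φ x * sgn (dot2 n u x))
      ≈⟨ *-congˡ (sumCube-cong n termwise) ⟩
    pow s n * sumCube n (λ x → sumFin m (λ i → α i * sgn (g i x xor dot2 n u x)))
      ≈⟨ *-congˡ (sumCube-sumFin-comm n m _) ⟩
    pow s n * sumFin m (λ i → sumCube n (λ x → α i * sgn (g i x xor dot2 n u x)))
      ≈⟨ *-congˡ (sumFin-cong m (λ i → sym (sumCube-distribˡ n (α i) _))) ⟩
    pow s n * sumFin m (λ i → α i * sumCube n (λ x → sgn (g i x xor dot2 n u x)))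
      ≈⟨ sumFin-distribˡ m _ _ ⟩
    sumFin m (λ i → pow s n * (α i * sumCube n (λ x → sgn (g i x xor dot2 n u x))))
      ≈⟨ sumFin-cong m (λ i → x∙yz≈y∙xz _ _ _) ⟩
    sumFin m (λ i → α i * walsh s n (g i) u) ∎
    where
    termwise : ∀ x → φ x * sgn (dot2 n u x) ≈ sumFin m (λ i → α i * sgn (g i x xor dot2 n u x))
    termwise x = begin
      φ x * sgn (dot2 n u x)
        ≈⟨ *-congʳ (φ≈ x) ⟩
      sumFin m (λ i → α i * sgn (g i x)) * sgn (dot2 n u x)
        ≈⟨ sumFin-distribʳ m _ _ ⟩
      sumFin m (λ i → (α i * sgn (g i x)) * sgn (dot2 n u x))
        ≈⟨ sumFin-cong m (λ i → trans (*-assoc _ _ _) (*-congˡ (sym (sgn-xor (g i x) (dot2 n u x))))) ⟩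
      sumFin m (λ i → α i * sgn (g i x xor dot2 n u x)) ∎

theorem3 : ∀ {c ℓ : Level} (R : CommutativeRing c ℓ)
    → let open CommutativeRing R in let open RingDefs R in
    (ζ s : Carrier) → (q : ℕ) → pow ζ q ≈ 1# → (s * s) * (1# + 1#) ≈ 1#
    → .{{_ : NonZero q}} → (n h : ℕ) → 2 ^ h < 2 ℕ.* q → q ≤ 2 ^ h
    → (f : (Fin n → Bool) → Fin q) (a : Fin h → (Fin n → Bool) → Bool)
    → (∀ x → toℕ (f x) ≡ sumℕ h (λ i → cvec h i ℕ.* b2n (a i x)))
    → (∀ x → pow ζ (toℕ (f x)) ≈ sumFin (2 ^ h) (λ i → alpha s ζ q h i * Theta n h a i x))
    × (∀ u → genWalsh s ζ q n f u ≈ sumFin (2 ^ h) (λ i → alpha s ζ q h i * walsh s n (comboFun n h a i) u))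
theorem3 R ζ s q _ s²2≈1 n h _ _ f a f-binary =
  expansion , walsh-of-expansion R s n _ (2 ^ h) (alpha s ζ q h) (comboFun n h a) expansion
  where
  open CommutativeRing R
  open RingDefs R
  Φ : (Fin h → Bool) → Carrier
  Φ y = pow ζ (odot q h y (cvec h))
  Φ-resp : Φ Preserves _≗_ ⟶ _≈_
  Φ-resp e = reflexive (≡.cong (pow ζ) (odot-congˡ q h (cvec h) e))
  expansion : ∀ x → pow ζ (toℕ (f x)) ≈ sumFin (2 ^ h) (λ i → alpha s ζ q h i * Theta n h a i x)
  expansion x = trans (reflexive (≡.cong (pow ζ) (≡.sym (odot-cvec-binary q h (λ j → a j x) (f x) (f-binary x)))))
                      (hadamard-expansion R s s²2≈1 h Φ Φ-resp (λ j → a j x))
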